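{- There exists an absolute constant $C_1\ge1$ with the following property. Fix real constants $C\ge1$ and $\frac34\le c\le1$. Let $(\zeta_1,\zeta_2)$ be a point of order $N\ge17$ in $\mathbb{G}_m^2$ (a pair of roots of unity whose orders have least common multiple $N$). Then there exist a primitive $N$-th root of unity $\zeta_N$, a positive integer $e$, integers $k_1,k_2$ with $\gcd(k_1,k_2)=1$ and $|(k_1,k_2)|_\infty\le N^c/e$, and $e$-th roots of unity $\zeta_e^{(1)},\zeta_e^{(2)}$ such that $(\zeta_1,\zeta_2)=(\zeta_e^{(1)}\zeta_N^{k_1},\zeta_e^{(2)}\zeta_N^{k_2})$. Moreover either $e\le C_1C^2N^{1-c}$ or $|(k_1,k_2)|_\infty> C$.
   Context: $|(k_1,k_2)|_\infty=\max\{|k_1|,|k_2|\}$.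
   Formalization: The constants C and c range over the rationals rather than over the reals. -}

module Defs where

open import Data.Nat as ℕ using (ℕ; _≤_; _<_; _^_; _∸_; _⊔_)
open import Data.Integer as ℤ using (ℤ; +_)
open import Data.Integer.GCD as ℤG using ()
open import Data.Rational.Unnormalised as Q using (ℚᵘ; _≃_)
open import Data.Product using (Σ; ∃; ∃-syntax; _×_)
open import Data.Sum using (_⊎_)
open import Relation.Binary.PropositionalEquality using (_≡_)
open import Relation.Nullary using (¬_)

-- Roots of unity are modelled via the standard isomorphism
--   μ∞ ≅ ℚ/ℤ ,  x ↦ exp(2πi x).
-- A root of unity is represented by x : ℚᵘ; multiplication of roots is
-- addition, the k-th power is multiplication by k, and two representatives
-- give the same root iff their difference is an integer.

IsInt : ℚᵘ → Set
IsInt x = ∃[ m ] (x ≃ (m Q./ 1))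

_≈μ_ : ℚᵘ → ℚᵘ → Set
x ≈μ y = IsInt (x Q.- y)

_^μ_ : ℚᵘ → ℤ → ℚᵘ
x ^μ k = (k Q./ 1) Q.* x

_·μ_ : ℚᵘ → ℚᵘ → ℚᵘ
x ·μ y = x Q.+ y

IsRootOfUnity : ℕ → ℚᵘ → Set
IsRootOfUnity n x = IsInt (x ^μ (+ n))

IsPrimitiveRoot : ℕ → ℚᵘ → Set
IsPrimitiveRoot N x =
  1 ≤ N × IsRootOfUnity N x × (∀ n → 1 ≤ n → n < N → ¬ IsRootOfUnity n x)

HasOrder² : ℕ → ℚᵘ → ℚᵘ → Set
HasOrder² N x₁ x₂ =
  1 ≤ N × IsRootOfUnity N x₁ × IsRootOfUnity N x₂ ×
  (∀ n → 1 ≤ n → IsRootOfUnity n x₁ → IsRootOfUnity n x₂ → N ≤ n)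

∣_,_∣∞ : ℤ → ℤ → ℕ
∣ k₁ , k₂ ∣∞ = ℤ.∣ k₁ ∣ ⊔ ℤ.∣ k₂ ∣

module Submission where

-- Write ζᵢ = exp(2πi aᵢ/N) with gcd(a₁, a₂, N) = 1. If k ∈ ℤ² is primitive and N ∣ e·det(a, k), then
-- a ≡ u₀·k modulo det(a, k) for some u₀ that is a unit modulo N/gcd(N, e); lifting it to a unit u modulo N
-- gives N ∣ e·(a − u·k), i.e. ζᵢ = ηᵢ·ζ_N^kᵢ with ζ_N = exp(2πi u/N) and ηᵢ^e = 1.
-- The vectors v with N ∣ det(a, v) form a lattice of index N, so by pigeonhole it has a vector v = g·k ≠ 0,
-- k primitive, with ‖v‖ ≤ √N. Let m be the order of det(a, k) modulo N; then m ∣ g and e = m works unless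
-- m > C₁C²N^(1-c) and ‖k‖ ≤ C. In that case a lattice vector w transversal to k with m·‖w‖ ≤ 2N yields the
-- pairwise non-parallel lattice vectors m·k + t·w, 0 < t ≤ (2C+1)² + 1. By pigeonhole one of them,
-- x = g′·k′ with k′ primitive, has ‖k′‖ > C, while ‖x‖ ≤ 21C²N/m ≤ N^c because m is large; take e = g′.

module Arithmetic where
  open import Data.Nat
  open import Data.Nat.Properties
  open import Data.Nat.DivMod using (m≡m%n+[m/n]*n; m%n<n)
  open import Data.Nat.Tactic.RingSolver using (solve-∀)
  open import Data.Product using (∃; _×_; _,_)
  open import Relation.Binary.PropositionalEquality
  open import Relation.Nullary using (yes; no; contradiction)

  ^-distribʳ-* : ∀ m n o → (m * n) ^ o ≡ m ^ o * n ^ o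
  ^-distribʳ-* m n zero    = refl
  ^-distribʳ-* m n (suc o) = begin
    m * n * (m * n) ^ o       ≡⟨ cong (m * n *_) (^-distribʳ-* m n o) ⟩
    m * n * (m ^ o * n ^ o)   ≡⟨ *-interchange m n (m ^ o) (n ^ o) ⟩
    m * m ^ o * (n * n ^ o)   ∎
    where
    open ≡-Reasoning
    *-interchange : ∀ a b c d → a * b * (c * d) ≡ a * c * (b * d)
    *-interchange = solve-∀

  3q≤4p⇒q≤p+p : ∀ p q → 3 * q ≤ 4 * p → q ≤ p + p
  3q≤4p⇒q≤p+p p q 3q≤4p = *-cancelˡ-≤ 2 (begin
    2 * q         ≤⟨ *-monoˡ-≤ q (n≤1+n 2) ⟩
    3 * q         ≤⟨ 3q≤4p ⟩
    4 * p         ≡⟨ identity p ⟩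
    2 * (p + p)   ∎)
    where
    open ≤-Reasoning
    identity : ∀ p → 4 * p ≡ 2 * (p + p)
    identity = solve-∀

  ⌊√_⌋ : ∀ n → ∃ λ b → b * b ≤ n × n < suc b * suc b
  ⌊√ zero ⌋ = 0 , z≤n , s≤s z≤n
  ⌊√ suc n ⌋ with ⌊√ n ⌋
  ... | b , b²≤n , n<[1+b]² with suc b * suc b ≤? suc n
  ...   | yes [1+b]²≤1+n = suc b , [1+b]²≤1+n ,
            ≤-trans (s≤s n<[1+b]²) (*-mono-< (n<1+n (suc b)) (n<1+n (suc b)))
  ...   | no  [1+b]²≰1+n = b , m≤n⇒m≤1+n b²≤n , ≰⇒> [1+b]²≰1+n

  m*m≤n*n⇒m≤n : ∀ m n → m * m ≤ n * n → m ≤ n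
  m*m≤n*n⇒m≤n m n m²≤n² with m ≤? n
  ... | yes m≤n = m≤n
  ... | no  m≰n = contradiction m²≤n² (<⇒≱ (*-mono-< (≰⇒> m≰n) (≰⇒> m≰n)))

  b*b≤n⇒b^q≤n^p : ∀ b n p q .{{_ : NonZero n}} → b * b ≤ n → q ≤ p + p → b ^ q ≤ n ^ p
  b*b≤n⇒b^q≤n^p b n p q b²≤n q≤2p = m*m≤n*n⇒m≤n (b ^ q) (n ^ p) (begin
    b ^ q * b ^ q   ≡⟨ ^-distribʳ-* b b q ⟨
    (b * b) ^ q     ≤⟨ ^-monoˡ-≤ q b²≤n ⟩
    n ^ q           ≤⟨ ^-monoʳ-≤ n q≤2p ⟩
    n ^ (p + p)     ≡⟨ ^-distribˡ-+-* n p p ⟩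
    n ^ p * n ^ p   ∎)
    where open ≤-Reasoning

  xy≤zn⇒x^q≤n^p : ∀ x y z n p q .{{_ : NonZero n}} → x * y ≤ z * n → z ^ q * n ^ (q ∸ p) < y ^ q → p ≤ q →
                     x ^ q ≤ n ^ p
  xy≤zn⇒x^q≤n^p x y z n p q xy≤zn small p≤q = <⇒≤ (*-cancelʳ-< (y ^ q) (x ^ q) (n ^ p) (begin-strict
    x ^ q * y ^ q                 ≡⟨ ^-distribʳ-* x y q ⟨
    (x * y) ^ q                   ≤⟨ ^-monoˡ-≤ q xy≤zn ⟩
    (z * n) ^ q                   ≡⟨ ^-distribʳ-* z n q ⟩
    z ^ q * n ^ q                 ≡⟨ cong (λ i → z ^ q * n ^ i) (m∸n+n≡m p≤q) ⟨
    z ^ q * n ^ (q ∸ p + p)       ≡⟨ cong (z ^ q *_) (^-distribˡ-+-* n (q ∸ p) p) ⟩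
    z ^ q * (n ^ (q ∸ p) * n ^ p) ≡⟨ *-assoc (z ^ q) _ _ ⟨
    z ^ q * n ^ (q ∸ p) * n ^ p   <⟨ *-monoˡ-< (n ^ p) {{m^n≢0 n p}} small ⟩
    y ^ q * n ^ p                 ≡⟨ *-comm (y ^ q) (n ^ p) ⟩
    n ^ p * y ^ q                 ∎))
    where open ≤-Reasoning

  m<[1+m/n]*n : ∀ m n .{{_ : NonZero n}} → m < suc (m / n) * n
  m<[1+m/n]*n m n = begin-strict
    m                     ≡⟨ m≡m%n+[m/n]*n m n ⟩
    m % n + m / n * n     <⟨ +-monoˡ-< (m / n * n) (m%n<n m n) ⟩
    n + m / n * n         ≡⟨⟩
    suc (m / n) * n       ∎
    where open ≤-Reasoning


module Lattice where
  open Arithmetic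
  open import Defs using (∣_,_∣∞)
  open import Data.Integer.Base as ℤ using (ℤ; +_; -[1+_]; ∣_∣; _+_; _*_; _-_; -_; 0ℤ; 1ℤ)
  import Data.Integer.Properties as ℤ
  open import Data.Integer.Divisibility.Signed using (_∣_; divides; ∣ᵤ⇒∣; ∣⇒∣ᵤ)
  import Data.Integer.Divisibility.Signed as ℤ
  import Data.Integer.DivMod as ℤ
  import Data.Integer.Coprimality as ℤ
  open import Data.Integer.Tactic.RingSolver using (solve-∀)
  open import Data.Nat.Base as ℕ using (ℕ; zero; suc; NonZero)
  import Data.Nat.Properties as ℕ
  import Data.Nat.Divisibility as ℕ
  import Data.Nat.DivMod as ℕ
  import Data.Nat.Tactic.RingSolver as ℕ
  open import Data.Nat.GCD as ℕ using (gcd)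
  open import Data.Nat.Coprimality as Coprimality using (Coprime)
  open import Algebra.Properties.CommutativeSemigroup ℤ.*-commutativeSemigroup
  open import Data.Fin.Base as Fin using (Fin; toℕ; fromℕ<; combine)
  import Data.Fin.Properties as Fin
  open import Data.Product using (∃; ∃₂; _×_; _,_; proj₁; proj₂; uncurry)
  open import Data.Product.Properties using (,-injectiveˡ; ,-injectiveʳ)
  open import Data.Sum using (_⊎_; inj₁; inj₂; [_,_]′)
  open import Function using (_∘_)
  open import Relation.Binary.PropositionalEquality
  open import Relation.Nullary using (¬_; Dec; yes; no; contradiction)

  abs-as-multiple : ∀ i → ∃ λ σ → + ∣ i ∣ ≡ σ * i
  abs-as-multiple (+ n)    = 1ℤ , sym (ℤ.*-identityˡ (+ n))
  abs-as-multiple -[1+ n ] = - 1ℤ , sym (ℤ.-1*i≡-i -[1+ n ])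

  1+yn≡xm⇒xm-yn≡1 : ∀ {x y m n} → 1 ℕ.+ y ℕ.* n ≡ x ℕ.* m → + x * + m + - + y * + n ≡ 1ℤ
  1+yn≡xm⇒xm-yn≡1 {x} {y} {m} {n} 1+yn≡xm = begin
    + x * + m + - + y * + n              ≡⟨ cong (λ i → i + - + y * + n) 1+yn≡xm′ ⟨
    1ℤ + + y * + n + - + y * + n         ≡⟨ cancel (+ y) (+ n) ⟩
    1ℤ                                   ∎
    where
    open ≡-Reasoning
    1+yn≡xm′ : 1ℤ + + y * + n ≡ + x * + m
    1+yn≡xm′ = begin
      1ℤ + + y * + n       ≡⟨ cong (λ i → 1ℤ + i) (ℤ.pos-* y n) ⟨
      + (1 ℕ.+ y ℕ.* n)    ≡⟨ cong (λ i → + i) 1+yn≡xm ⟩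
      + (x ℕ.* m)          ≡⟨ ℤ.pos-* x m ⟩
      + x * + m            ∎
    cancel : ∀ y n → 1ℤ + y * n + - y * n ≡ 1ℤ
    cancel = solve-∀

  bézout-ℕ : ∀ {m n} → ℕ.Bézout.Identity 1 m n → ∃₂ λ x y → x * + m + y * + n ≡ 1ℤ
  bézout-ℕ {m} {n} (ℕ.Bézout.+- x y 1+yn≡xm) =
    + x , - + y , 1+yn≡xm⇒xm-yn≡1 {x} {y} {m} {n} 1+yn≡xm
  bézout-ℕ {m} {n} (ℕ.Bézout.-+ x y 1+xm≡yn) =
    - + x , + y , trans (ℤ.+-comm (- + x * + m) (+ y * + n)) (1+yn≡xm⇒xm-yn≡1 {y} {x} {n} {m} 1+xm≡yn)

  bézout : ∀ a b → Coprime ∣ a ∣ ∣ b ∣ → ∃₂ λ x y → x * a + y * b ≡ 1ℤ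
  bézout a b coprime
    with σ , ∣a∣≡σa ← abs-as-multiple a | τ , ∣b∣≡τb ← abs-as-multiple b
    with x , y , x∣a∣+y∣b∣≡1 ← bézout-ℕ (Coprimality.coprime-Bézout coprime)
    = x * σ , y * τ , (begin
      x * σ * a + y * τ * b          ≡⟨ cong₂ _+_ (ℤ.*-assoc x σ a) (ℤ.*-assoc y τ b) ⟩
      x * (σ * a) + y * (τ * b)      ≡⟨ cong₂ (λ i j → x * i + y * j) ∣a∣≡σa ∣b∣≡τb ⟨
      x * + ∣ a ∣ + y * + ∣ b ∣      ≡⟨ x∣a∣+y∣b∣≡1 ⟩
      1ℤ                             ∎)
    where open ≡-Reasoning

  linear-congruence : ∀ m .{{_ : NonZero m}} δ X → Coprime ∣ δ ∣ m → ∃ λ ℓ → ℓ ℕ.< m × + m ∣ + ℓ * δ - X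
  linear-congruence m δ X δ⊥m =
    let x , y , xδ+ym≡1 = bézout δ (+ m) δ⊥m
        ℓ = (X * x) ℤ.%ℕ m
        q = (X * x) ℤ./ℕ m
    in  ℓ , ℤ.n%ℕd<d (X * x) m , divides (- (X * y) - q * δ) (begin
          + ℓ * δ - X
            ≡⟨ cong₂ (λ i j → i * δ - j) (ℓ≡ (X * x)) (×bézout X {x} {y} xδ+ym≡1) ⟩
          (X * x - q * + m) * δ - X * (x * δ + y * + m) ≡⟨ identity X x q (+ m) δ y ⟩
          (- (X * y) - q * δ) * + m                  ∎)
    where
    open ≡-Reasoning
    ℓ≡ : ∀ z → + (z ℤ.%ℕ m) ≡ z - z ℤ./ℕ m * + m
    ℓ≡ z = begin
      + (z ℤ.%ℕ m)                                   ≡⟨ r≡r+t-t (+ (z ℤ.%ℕ m)) (z ℤ./ℕ m * + m) ⟩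
      + (z ℤ.%ℕ m) + z ℤ./ℕ m * + m - z ℤ./ℕ m * + m ≡⟨ cong (_- z ℤ./ℕ m * + m) (ℤ.a≡a%ℕn+[a/ℕn]*n z m) ⟨
      z - z ℤ./ℕ m * + m                             ∎
      where
      r≡r+t-t : ∀ r t → r ≡ r + t - t
      r≡r+t-t = solve-∀
    ×bézout : ∀ X {x y} → x * δ + y * + m ≡ 1ℤ → X ≡ X * (x * δ + y * + m)
    ×bézout X bz = trans (sym (ℤ.*-identityʳ X)) (cong (X *_) (sym bz))
    identity : ∀ X x q m δ y → (X * x - q * m) * δ - X * (x * δ + y * m) ≡ (- (X * y) - q * δ) * m
    identity = solve-∀

  *-≢0 : ∀ {i j} → i ≢ 0ℤ → j ≢ 0ℤ → i * j ≢ 0ℤ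
  *-≢0 {i} i≢0 j≢0 ij≡0 = [ i≢0 , j≢0 ]′ (ℤ.i*j≡0⇒i≡0∨j≡0 i ij≡0)

  %ℕ≡⇒∣- : ∀ n x y .{{_ : NonZero n}} → x ℤ.%ℕ n ≡ y ℤ.%ℕ n → + n ∣ x - y
  %ℕ≡⇒∣- n x y x%n≡y%n = divides (x ℤ./ℕ n - y ℤ./ℕ n) (begin
    x - y                                           ≡⟨ cong₂ _-_ (ℤ.a≡a%ℕn+[a/ℕn]*n x n) (ℤ.a≡a%ℕn+[a/ℕn]*n y n) ⟩
    (+ (x ℤ.%ℕ n) + x ℤ./ℕ n * + n) - (+ (y ℤ.%ℕ n) + y ℤ./ℕ n * + n)
                                                    ≡⟨ cong (λ r → (+ r + x ℤ./ℕ n * + n) - (+ (y ℤ.%ℕ n) + y ℤ./ℕ n * + n)) x%n≡y%n ⟩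
    (+ (y ℤ.%ℕ n) + x ℤ./ℕ n * + n) - (+ (y ℤ.%ℕ n) + y ℤ./ℕ n * + n)
                                                    ≡⟨ identity (+ (y ℤ.%ℕ n)) (x ℤ./ℕ n) (y ℤ./ℕ n) (+ n) ⟩
    (x ℤ./ℕ n - y ℤ./ℕ n) * + n                     ∎)
    where
    open ≡-Reasoning
    identity : ∀ r q q′ n → (r + q * n) - (r + q′ * n) ≡ (q - q′) * n
    identity = solve-∀

  ∣m-n∣≤ : ∀ {b} m n → m ℕ.≤ b → n ℕ.≤ b → ∣ + m - + n ∣ ℕ.≤ b
  ∣m-n∣≤ m n m≤b n≤b = ℕ.≤-trans (ℕ.≤-reflexive (cong ∣_∣ (ℤ.[+m]-[+n]≡m⊖n m n)))
                                 (ℕ.≤-trans (ℤ.∣m⊝n∣≤m⊔n m n) (ℕ.⊔-lub m≤b n≤b))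

  -- D / N = numerator / denominator in lowest terms; the denominator is the order of D in ℤ/Nℤ.
  record ReducedFraction (D : ℤ) (N : ℕ) : Set where
    field
      numerator : ℤ
      denominator common : ℕ
      N≡denominator*common : N ≡ denominator ℕ.* common
      D≡numerator*common : D ≡ numerator * + common
      coprime : Coprime denominator ∣ numerator ∣

  reduce : ∀ D N .{{_ : NonZero N}} → ReducedFraction D N
  reduce D N = record
    { numerator = numerator
    ; denominator = N ℕ./ g
    ; common = g
    ; N≡denominator*common = sym (ℕ.m/n*n≡m (ℕ.gcd[m,n]∣m N ∣ D ∣))
    ; D≡numerator*common = _∣_.equality g∣D
    ; coprime = subst (Coprime (N ℕ./ g)) (sym ∣numerator∣≡∣D∣/g) (Coprimality.coprime-/gcd N ∣ D ∣)
    }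
    where
    g = gcd N ∣ D ∣
    instance
      g≢0 : NonZero g
      g≢0 = ℕ.≢-nonZero (ℕ.gcd[m,n]≢0 N ∣ D ∣ (inj₁ (ℕ.≢-nonZero⁻¹ N)))
    g∣D : + g ∣ D
    g∣D = ∣ᵤ⇒∣ (ℕ.gcd[m,n]∣n N ∣ D ∣)
    numerator = _∣_.quotient g∣D
    ∣numerator∣≡∣D∣/g : ∣ numerator ∣ ≡ ∣ D ∣ ℕ./ g
    ∣numerator∣≡∣D∣/g = begin
      ∣ numerator ∣                          ≡⟨ ℕ.m*n/n≡m ∣ numerator ∣ g ⟨
      ∣ numerator ∣ ℕ.* g ℕ./ g              ≡⟨ cong (ℕ._/ g) (ℤ.abs-* numerator (+ g)) ⟨
      ∣ numerator * + g ∣ ℕ./ g              ≡⟨ cong (λ i → ∣ i ∣ ℕ./ g) (_∣_.equality g∣D) ⟨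
      ∣ D ∣ ℕ./ g                            ∎
      where open ≡-Reasoning

  module _ {D N} .{{N≢0 : NonZero N}} (R : ReducedFraction D N) where
    open ReducedFraction R

    common≢0 : NonZero common
    common≢0 = ℕ.m*n≢0⇒n≢0 denominator {{subst NonZero N≡denominator*common N≢0}}

    denominator≢0 : NonZero denominator
    denominator≢0 = ℕ.m*n≢0⇒m≢0 denominator {{subst NonZero N≡denominator*common N≢0}}

    +N≡denominator*common : + N ≡ + denominator * + common
    +N≡denominator*common = trans (cong (λ i → + i) N≡denominator*common) (ℤ.pos-* denominator common)

    N∣denominator*D : + N ∣ + denominator * D
    N∣denominator*D = divides numerator (begin
      + denominator * D                        ≡⟨ cong (λ i → + denominator * i) D≡numerator*common ⟩
      + denominator * (numerator * + common)   ≡⟨ x∙yz≈y∙xz (+ denominator) numerator (+ common) ⟩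
      numerator * (+ denominator * + common)   ≡⟨ cong (λ i → numerator * i) +N≡denominator*common ⟨
      numerator * + N                          ∎)
      where open ≡-Reasoning

    denominator-minimal : ∀ x → + N ∣ x * D → + denominator ∣ x
    denominator-minimal x N∣xD = ∣ᵤ⇒∣ (ℤ.coprime-divisor (+ denominator) numerator x coprime
      (∣⇒∣ᵤ (ℤ.*-cancelʳ-∣ (+ common) {+ denominator} {numerator * x} {{common≢0}}
               (subst₂ _∣_ +N≡denominator*common xD≡ N∣xD))))
      where
      xD≡ : x * D ≡ numerator * x * + common
      xD≡ = begin
        x * D                     ≡⟨ cong (λ i → x * i) D≡numerator*common ⟩
        x * (numerator * + common) ≡⟨ x∙yz≈yx∙z x numerator (+ common) ⟩
        numerator * x * + common  ∎
        where open ≡-Reasoning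

  -- Repeatedly divides n by gcd(n, w); with fuel ≥ n the result is the largest divisor of n coprime to w.
  coprimePart : ℕ → ℕ → ℕ → ℕ
  coprimePart zero       n w = n
  coprimePart (suc fuel) n w with gcd n w ℕ.≟ 1
  ... | yes _ = n
  ... | no  _ = coprimePart fuel (ℕ.quotient (ℕ.gcd[m,n]∣m n w)) w

  coprimePart-coprime : ∀ fuel n w .{{_ : NonZero n}} → n ℕ.≤ fuel → Coprime (coprimePart fuel n w) w
  coprimePart-coprime zero       n w n≤0 = contradiction n≤0 (ℕ.<⇒≱ (ℕ.>-nonZero⁻¹ n))
  coprimePart-coprime (suc fuel) n w n≤1+fuel with gcd n w ℕ.≟ 1
  ... | yes g≡1 = Coprimality.gcd≡1⇒coprime g≡1
  ... | no  g≢1 = coprimePart-coprime fuel (ℕ.quotient g∣n) w {{ℕ.quotient≢0 g∣n}}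
                    (ℕ.s≤s⁻¹ (ℕ.<-≤-trans (ℕ.quotient-< g∣n) n≤1+fuel))
    where
    g∣n = ℕ.gcd[m,n]∣m n w
    instance
      g>1 : ℕ.NonTrivial (gcd n w)
      g>1 = ℕ.n>1⇒nonTrivial
              (ℕ.≤∧≢⇒< (ℕ.n≢0⇒n>0 (ℕ.gcd[m,n]≢0 n w (inj₁ (ℕ.≢-nonZero⁻¹ n)))) (g≢1 ∘ sym))

  coprimePart-greatest : ∀ fuel n w {z} → z ℕ.∣ n → Coprime z w → z ℕ.∣ coprimePart fuel n w
  coprimePart-greatest zero       n w z∣n _ = z∣n
  coprimePart-greatest (suc fuel) n w z∣n z⊥w with gcd n w ℕ.≟ 1
  ... | yes _ = z∣n
  ... | no  _ = coprimePart-greatest fuel _ w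
                  (Coprimality.coprime-divisor z⊥g (subst (_ ℕ.∣_) (ℕ.m∣n⇒n≡m*quotient g∣n) z∣n)) z⊥w
    where
    g∣n = ℕ.gcd[m,n]∣m n w
    z⊥g : Coprime _ (gcd n w)
    z⊥g (d∣z , d∣g) = z⊥w (d∣z , ℕ.∣-trans d∣g (ℕ.gcd[m,n]∣n n w))

  -- u = w + M·y with y the largest divisor of N coprime to w: every prime factor of N divides exactly
  -- one of w and M·y.
  lift-unit : ∀ {M N} w .{{_ : NonZero N}} → M ℕ.∣ N → Coprime ∣ w ∣ M →
              ∃ λ u → (+ M ∣ u - w) × Coprime ∣ u ∣ N
  lift-unit {M} {N} w M∣N w⊥M = u , divides (+ y) (trans u-w≡My (ℤ.*-comm (+ M) (+ y))) , u⊥N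
    where
    y = coprimePart N N ∣ w ∣
    u = w + + M * + y
    u-w≡My : u - w ≡ + M * + y
    u-w≡My = w+x-w≡x w (+ M * + y)
      where
      w+x-w≡x : ∀ w x → w + x - w ≡ x
      w+x-w≡x = solve-∀
    u-My≡w : u - + M * + y ≡ w
    u-My≡w = w+x-x≡w w (+ M * + y)
      where
      w+x-x≡w : ∀ w x → w + x - x ≡ w
      w+x-x≡w = solve-∀
    M*y∣ : ∀ {c} → c ℕ.∣ M ℕ.* y → + c ∣ + M * + y
    M*y∣ c∣My = ∣ᵤ⇒∣ (subst (λ i → _ ℕ.∣ ∣ i ∣) (ℤ.pos-* M y) c∣My)
    u⊥w : Coprime ∣ u ∣ ∣ w ∣
    u⊥w {c} (c∣u , c∣w) = coprimePart-coprime N N ∣ w ∣ ℕ.≤-refl (c∣y , c∣w)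
      where
      c⊥M : Coprime c M
      c⊥M (d∣c , d∣M) = w⊥M (ℕ.∣-trans d∣c c∣w , d∣M)
      c∣My : c ℕ.∣ M ℕ.* y
      c∣My = subst (λ i → c ℕ.∣ ∣ i ∣) (trans u-w≡My (sym (ℤ.pos-* M y)))
               (∣⇒∣ᵤ (ℤ.∣m∣n⇒∣m-n (∣ᵤ⇒∣ {+ c} {u} c∣u) (∣ᵤ⇒∣ {+ c} {w} c∣w)))
      c∣y : c ℕ.∣ y
      c∣y = Coprimality.coprime-divisor c⊥M c∣My
    u⊥N : Coprime ∣ u ∣ N
    u⊥N {z} (z∣u , z∣N) = u⊥w (z∣u , z∣w)
      where
      z⊥w : Coprime z ∣ w ∣
      z⊥w (d∣z , d∣w) = u⊥w (ℕ.∣-trans d∣z z∣u , d∣w)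
      z∣y : z ℕ.∣ y
      z∣y = coprimePart-greatest N N ∣ w ∣ z∣N z⊥w
      z∣w : z ℕ.∣ ∣ w ∣
      z∣w = ∣⇒∣ᵤ (subst (+ z ∣_) u-My≡w
              (ℤ.∣m∣n⇒∣m-n (∣ᵤ⇒∣ {+ z} {u} z∣u) (M*y∣ (ℕ.∣n⇒∣m*n M z∣y))))

  ℤ² : Set
  ℤ² = ℤ × ℤ

  0² : ℤ²
  0² = 0ℤ , 0ℤ

  infixr 7 _·_
  infixl 6 _+²_ _-²_
  infix 4 _∣²_

  _·_ : ℤ → ℤ² → ℤ²
  c · (v₁ , v₂) = c * v₁ , c * v₂

  _+²_ : ℤ² → ℤ² → ℤ²
  (u₁ , u₂) +² (v₁ , v₂) = u₁ + v₁ , u₂ + v₂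

  _-²_ : ℤ² → ℤ² → ℤ²
  (u₁ , u₂) -² (v₁ , v₂) = u₁ - v₁ , u₂ - v₂

  _∣²_ : ℤ → ℤ² → Set
  d ∣² (v₁ , v₂) = (d ∣ v₁) × (d ∣ v₂)

  det : ℤ² → ℤ² → ℤ
  det (u₁ , u₂) (v₁ , v₂) = u₁ * v₂ - u₂ * v₁

  ‖_‖ : ℤ² → ℕ
  ‖ v₁ , v₂ ‖ = ∣ v₁ , v₂ ∣∞

  det-·ˡ : ∀ c u v → det (c · u) v ≡ c * det u v
  det-·ˡ c (u₁ , u₂) (v₁ , v₂) = identity c u₁ u₂ v₁ v₂
    where
    identity : ∀ c u₁ u₂ v₁ v₂ → c * u₁ * v₂ - c * u₂ * v₁ ≡ c * (u₁ * v₂ - u₂ * v₁)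
    identity = solve-∀

  det-·ʳ : ∀ c u v → det u (c · v) ≡ c * det u v
  det-·ʳ c (u₁ , u₂) (v₁ , v₂) = identity c u₁ u₂ v₁ v₂
    where
    identity : ∀ c u₁ u₂ v₁ v₂ → u₁ * (c * v₂) - u₂ * (c * v₁) ≡ c * (u₁ * v₂ - u₂ * v₁)
    identity = solve-∀

  det-+²ʳ : ∀ u v w → det u (v +² w) ≡ det u v + det u w
  det-+²ʳ (u₁ , u₂) (v₁ , v₂) (w₁ , w₂) = identity u₁ u₂ v₁ v₂ w₁ w₂
    where
    identity : ∀ u₁ u₂ v₁ v₂ w₁ w₂ →
               u₁ * (v₂ + w₂) - u₂ * (v₁ + w₁) ≡ (u₁ * v₂ - u₂ * v₁) + (u₁ * w₂ - u₂ * w₁)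
    identity = solve-∀

  det-minusʳ : ∀ u v w → det u (v -² w) ≡ det u v - det u w
  det-minusʳ (u₁ , u₂) (v₁ , v₂) (w₁ , w₂) = identity u₁ u₂ v₁ v₂ w₁ w₂
    where
    identity : ∀ u₁ u₂ v₁ v₂ w₁ w₂ →
               u₁ * (v₂ - w₂) - u₂ * (v₁ - w₁) ≡ (u₁ * v₂ - u₂ * v₁) - (u₁ * w₂ - u₂ * w₁)
    identity = solve-∀

  det-self : ∀ v → det v v ≡ 0ℤ
  det-self (v₁ , v₂) = identity v₁ v₂
    where
    identity : ∀ v₁ v₂ → v₁ * v₂ - v₂ * v₁ ≡ 0ℤ
    identity = solve-∀

  det-·+²· : ∀ c i j k w → det (c · k +² i · w) (c · k +² j · w) ≡ c * ((j - i) * det k w)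
  det-·+²· c i j (k₁ , k₂) (w₁ , w₂) = identity c i j k₁ k₂ w₁ w₂
    where
    identity : ∀ c i j k₁ k₂ w₁ w₂ →
      (c * k₁ + i * w₁) * (c * k₂ + j * w₂) - (c * k₂ + i * w₂) * (c * k₁ + j * w₁) ≡
      c * ((j - i) * (k₁ * w₂ - k₂ * w₁))
    identity = solve-∀

  det-·+²ʳ : ∀ c i k w → det k (c · k +² i · w) ≡ i * det k w
  det-·+²ʳ c i (k₁ , k₂) (w₁ , w₂) = identity c i k₁ k₂ w₁ w₂
    where
    identity : ∀ c i k₁ k₂ w₁ w₂ →
      k₁ * (c * k₂ + i * w₂) - k₂ * (c * k₁ + i * w₁) ≡ i * (k₁ * w₂ - k₂ * w₁)
    identity = solve-∀

  det≢0⇒≢0² : ∀ u v → det u v ≢ 0ℤ → v ≢ 0²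
  det≢0⇒≢0² (u₁ , u₂) v det≢0 refl = det≢0 (identity u₁ u₂)
    where
    identity : ∀ u₁ u₂ → u₁ * 0ℤ - u₂ * 0ℤ ≡ 0ℤ
    identity = solve-∀

  -²≡0²⇒≡ : ∀ u v → u -² v ≡ 0² → u ≡ v
  -²≡0²⇒≡ (u₁ , u₂) (v₁ , v₂) u-v≡0 =
    cong₂ _,_ (ℤ.i-j≡0⇒i≡j u₁ v₁ (,-injectiveˡ u-v≡0)) (ℤ.i-j≡0⇒i≡j u₂ v₂ (,-injectiveʳ u-v≡0))

  ∣v₁∣≤‖v‖ : ∀ v → ∣ proj₁ v ∣ ℕ.≤ ‖ v ‖
  ∣v₁∣≤‖v‖ (v₁ , v₂) = ℕ.m≤m⊔n (∣ v₁ ∣) (∣ v₂ ∣)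

  ∣v₂∣≤‖v‖ : ∀ v → ∣ proj₂ v ∣ ℕ.≤ ‖ v ‖
  ∣v₂∣≤‖v‖ (v₁ , v₂) = ℕ.m≤n⊔m (∣ v₁ ∣) (∣ v₂ ∣)

  ‖‖≢0 : ∀ v → v ≢ 0² → NonZero ‖ v ‖
  ‖‖≢0 v v≢0 = ℕ.≢-nonZero λ ‖v‖≡0 → v≢0 (cong₂ _,_
    (ℤ.∣i∣≡0⇒i≡0 (ℕ.n≤0⇒n≡0 (subst (∣ proj₁ v ∣ ℕ.≤_) ‖v‖≡0 (∣v₁∣≤‖v‖ v))))
    (ℤ.∣i∣≡0⇒i≡0 (ℕ.n≤0⇒n≡0 (subst (∣ proj₂ v ∣ ℕ.≤_) ‖v‖≡0 (∣v₂∣≤‖v‖ v)))))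

  ‖·‖ : ∀ c v → ‖ c · v ‖ ≡ ∣ c ∣ ℕ.* ‖ v ‖
  ‖·‖ c (v₁ , v₂) = begin
    ∣ c * v₁ ∣ ℕ.⊔ ∣ c * v₂ ∣                    ≡⟨ cong₂ ℕ._⊔_ (ℤ.abs-* c v₁) (ℤ.abs-* c v₂) ⟩
    (∣ c ∣ ℕ.* ∣ v₁ ∣) ℕ.⊔ (∣ c ∣ ℕ.* ∣ v₂ ∣)    ≡⟨ ℕ.*-distribˡ-⊔ (∣ c ∣) (∣ v₁ ∣) (∣ v₂ ∣) ⟨
    ∣ c ∣ ℕ.* (∣ v₁ ∣ ℕ.⊔ ∣ v₂ ∣)                ∎
    where open ≡-Reasoning

  ‖+²‖ : ∀ u v → ‖ u +² v ‖ ℕ.≤ ‖ u ‖ ℕ.+ ‖ v ‖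
  ‖+²‖ (u₁ , u₂) (v₁ , v₂) = ℕ.⊔-lub
    (ℕ.≤-trans (ℤ.∣i+j∣≤∣i∣+∣j∣ u₁ v₁) (ℕ.+-mono-≤ (∣v₁∣≤‖v‖ (u₁ , u₂)) (∣v₁∣≤‖v‖ (v₁ , v₂))))
    (ℕ.≤-trans (ℤ.∣i+j∣≤∣i∣+∣j∣ u₂ v₂) (ℕ.+-mono-≤ (∣v₂∣≤‖v‖ (u₁ , u₂)) (∣v₂∣≤‖v‖ (v₁ , v₂))))

  content : ℤ² → ℕ
  content (v₁ , v₂) = gcd (∣ v₁ ∣) (∣ v₂ ∣)

  content∣₁ : ∀ v → + content v ∣ proj₁ v
  content∣₁ (v₁ , v₂) = ∣ᵤ⇒∣ (ℕ.gcd[m,n]∣m (∣ v₁ ∣) (∣ v₂ ∣))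

  content∣₂ : ∀ v → + content v ∣ proj₂ v
  content∣₂ (v₁ , v₂) = ∣ᵤ⇒∣ (ℕ.gcd[m,n]∣n (∣ v₁ ∣) (∣ v₂ ∣))

  primitivePart : ℤ² → ℤ²
  primitivePart v = _∣_.quotient (content∣₁ v) , _∣_.quotient (content∣₂ v)

  content·primitivePart : ∀ v → + content v · primitivePart v ≡ v
  content·primitivePart v = cong₂ _,_
    (trans (ℤ.*-comm (+ content v) _) (sym (_∣_.equality (content∣₁ v))))
    (trans (ℤ.*-comm (+ content v) _) (sym (_∣_.equality (content∣₂ v))))

  content-· : ∀ c v → content (c · v) ≡ ∣ c ∣ ℕ.* content v
  content-· c (v₁ , v₂) = begin
    gcd (∣ c * v₁ ∣) (∣ c * v₂ ∣)                ≡⟨ cong₂ gcd (ℤ.abs-* c v₁) (ℤ.abs-* c v₂) ⟩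
    gcd (∣ c ∣ ℕ.* ∣ v₁ ∣) (∣ c ∣ ℕ.* ∣ v₂ ∣)    ≡⟨ ℕ.c*gcd[m,n]≡gcd[cm,cn] (∣ c ∣) (∣ v₁ ∣) (∣ v₂ ∣) ⟨
    ∣ c ∣ ℕ.* gcd (∣ v₁ ∣) (∣ v₂ ∣)              ∎
    where open ≡-Reasoning

  content≢0 : ∀ v → v ≢ 0² → NonZero (content v)
  content≢0 (v₁ , v₂) v≢0 = ℕ.≢-nonZero λ gcd≡0 → v≢0 (cong₂ _,_
    (ℤ.∣i∣≡0⇒i≡0 (ℕ.gcd[m,n]≡0⇒m≡0 gcd≡0)) (ℤ.∣i∣≡0⇒i≡0 (ℕ.gcd[m,n]≡0⇒n≡0 (∣ v₁ ∣) gcd≡0)))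

  content≡1⇒≢0² : ∀ k → content k ≡ 1 → k ≢ 0²
  content≡1⇒≢0² k content≡1 refl = contradiction (trans (sym ℕ.gcd[0,0]≡0) content≡1) λ ()

  primitivePart-primitive : ∀ v → v ≢ 0² → content (primitivePart v) ≡ 1
  primitivePart-primitive v v≢0 = ℕ.*-cancelˡ-≡ _ 1 (content v) {{content≢0 v v≢0}} (begin
    content v ℕ.* content (primitivePart v)   ≡⟨ content-· (+ content v) (primitivePart v) ⟨
    content (+ content v · primitivePart v)   ≡⟨ cong content (content·primitivePart v) ⟩
    content v                                 ≡⟨ ℕ.*-identityʳ (content v) ⟨
    content v ℕ.* 1                           ∎)
    where open ≡-Reasoning

  ‖‖≡content*‖primitivePart‖ : ∀ v → ‖ v ‖ ≡ content v ℕ.* ‖ primitivePart v ‖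
  ‖‖≡content*‖primitivePart‖ v = trans (cong ‖_‖ (sym (content·primitivePart v))) (‖·‖ (+ content v) (primitivePart v))

  same-direction⇒det≡0 : ∀ u v → primitivePart u ≡ primitivePart v → det u v ≡ 0ℤ
  same-direction⇒det≡0 u v same = begin
    det u v                                                   ≡⟨ cong₂ det (content·primitivePart u) (content·primitivePart v) ⟨
    det (+ content u · primitivePart u) (+ content v · primitivePart v)
                                        ≡⟨ cong (λ k → det (+ content u · primitivePart u) (+ content v · k)) same ⟨
    det (+ content u · k) (+ content v · k)                   ≡⟨ det-·ˡ (+ content u) k _ ⟩
    + content u * det k (+ content v · k)                     ≡⟨ cong (+ content u *_) (det-·ʳ (+ content v) k k) ⟩
    + content u * (+ content v * det k k)                     ≡⟨ cong (λ i → + content u * (+ content v * i)) (det-self k) ⟩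
    + content u * (+ content v * 0ℤ)                          ≡⟨ cong (+ content u *_) (ℤ.*-zeroʳ (+ content v)) ⟩
    + content u * 0ℤ                                          ≡⟨ ℤ.*-zeroʳ (+ content u) ⟩
    0ℤ                                                        ∎
    where
    open ≡-Reasoning
    k = primitivePart u

  boxSize : ℕ → ℕ
  boxSize C = suc (C ℕ.+ C) ℕ.* suc (C ℕ.+ C)

  coordinateCode : ∀ {C} d → ∣ d ∣ ℕ.≤ C → Fin (suc (C ℕ.+ C))
  coordinateCode {C} d ∣d∣≤C =
    fromℕ< (ℕ.s≤s (ℕ.≤-trans (ℤ.∣i+j∣≤∣i∣+∣j∣ d (+ C)) (ℕ.+-monoˡ-≤ C ∣d∣≤C)))

  +∣d+C∣≡d+C : ∀ {C} d → ∣ d ∣ ℕ.≤ C → + ∣ d + + C ∣ ≡ d + + C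
  +∣d+C∣≡d+C (+ n)     _       = refl
  +∣d+C∣≡d+C -[1+ n ] 1+n≤C rewrite ℤ.⊖-≥ 1+n≤C = refl

  coordinateCode-injective : ∀ {C} d e (p : ∣ d ∣ ℕ.≤ C) (q : ∣ e ∣ ℕ.≤ C) →
                             coordinateCode d p ≡ coordinateCode e q → d ≡ e
  coordinateCode-injective {C} d e p q code≡ = begin
    d                 ≡⟨ d+C-C≡d d (+ C) ⟨
    d + + C - + C     ≡⟨ cong (_- + C) (+∣d+C∣≡d+C d p) ⟨
    + ∣ d + + C ∣ - + C ≡⟨ cong (λ i → + i - + C) ∣d+C∣≡∣e+C∣ ⟩
    + ∣ e + + C ∣ - + C ≡⟨ cong (_- + C) (+∣d+C∣≡d+C e q) ⟩
    e + + C - + C     ≡⟨ d+C-C≡d e (+ C) ⟩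
    e                 ∎
    where
    open ≡-Reasoning
    ∣d+C∣≡∣e+C∣ : ∣ d + + C ∣ ≡ ∣ e + + C ∣
    ∣d+C∣≡∣e+C∣ = trans (sym (Fin.toℕ-fromℕ< _)) (trans (cong toℕ code≡) (Fin.toℕ-fromℕ< _))
    d+C-C≡d : ∀ d c → d + c - c ≡ d
    d+C-C≡d = solve-∀

  vectorCode : ∀ {C} v → ‖ v ‖ ℕ.≤ C → Fin (boxSize C)
  vectorCode v ‖v‖≤C = combine (coordinateCode (proj₁ v) (ℕ.≤-trans (∣v₁∣≤‖v‖ v) ‖v‖≤C))
                               (coordinateCode (proj₂ v) (ℕ.≤-trans (∣v₂∣≤‖v‖ v) ‖v‖≤C))

  vectorCode-injective : ∀ {C} u v (p : ‖ u ‖ ℕ.≤ C) (q : ‖ v ‖ ℕ.≤ C) →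
                         vectorCode u p ≡ vectorCode v q → u ≡ v
  vectorCode-injective (u₁ , u₂) (v₁ , v₂) p q code≡
    with code₁≡ , code₂≡ ← Fin.combine-injective _ _ _ _ code≡
    = cong₂ _,_
        (coordinateCode-injective u₁ v₁ (ℕ.≤-trans (∣v₁∣≤‖v‖ (u₁ , u₂)) p) (ℕ.≤-trans (∣v₁∣≤‖v‖ (v₁ , v₂)) q)
                                  code₁≡)
        (coordinateCode-injective u₂ v₂ (ℕ.≤-trans (∣v₂∣≤‖v‖ (u₁ , u₂)) p) (ℕ.≤-trans (∣v₂∣≤‖v‖ (v₁ , v₂)) q)
                                  code₂≡)

  pigeonhole-parallel : ∀ C {T} → boxSize C ℕ.< T → (x : Fin T → ℤ²) →
                        (∀ t → ‖ primitivePart (x t) ‖ ℕ.≤ C) →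
                        ∃₂ λ i j → i Fin.< j × det (x i) (x j) ≡ 0ℤ
  pigeonhole-parallel C box<T x short
    with i , j , i<j , code≡ ← Fin.pigeonhole box<T (λ t → vectorCode (primitivePart (x t)) (short t))
    = i , j , i<j , same-direction⇒det≡0 (x i) (x j)
                      (vectorCode-injective (primitivePart (x i)) (primitivePart (x j)) (short i) (short j) code≡)

  long-primitivePart : ∀ C {T} → boxSize C ℕ.< T → (x : Fin T → ℤ²) →
                       (∀ {i j} → i Fin.< j → det (x i) (x j) ≢ 0ℤ) →
                       ∃ λ t → C ℕ.< ‖ primitivePart (x t) ‖
  long-primitivePart C box<T x independent with Fin.any? (λ t → C ℕ.<? ‖ primitivePart (x t) ‖)
  ... | yes long = long
  ... | no  none =
    let i , j , i<j , det≡0 = pigeonhole-parallel C box<T x (λ t → ℕ.≮⇒≥ (λ C<‖‖ → none (t , C<‖‖)))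
    in  contradiction det≡0 (independent i<j)

  boxSize-bound : ∀ C s r → 1 ℕ.≤ C → C ℕ.* s ℕ.≤ r →
                  (3 ℕ.+ 2 ℕ.* boxSize C) ℕ.* (s ℕ.* s) ℕ.≤ 21 ℕ.* (r ℕ.* r)
  boxSize-bound (suc c) s r _ Cs≤r = begin
    (3 ℕ.+ 2 ℕ.* boxSize (suc c)) ℕ.* (s ℕ.* s)
      ≤⟨ ℕ.*-monoˡ-≤ (s ℕ.* s) (ℕ.m≤m+n (3 ℕ.+ 2 ℕ.* boxSize (suc c)) (13 ℕ.* c ℕ.* c ℕ.+ 18 ℕ.* c)) ⟩
    (3 ℕ.+ 2 ℕ.* boxSize (suc c) ℕ.+ (13 ℕ.* c ℕ.* c ℕ.+ 18 ℕ.* c)) ℕ.* (s ℕ.* s)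
                                                  ≡⟨ identity c s ⟩
    21 ℕ.* (suc c ℕ.* s ℕ.* (suc c ℕ.* s))        ≤⟨ ℕ.*-monoʳ-≤ 21 (ℕ.*-mono-≤ Cs≤r Cs≤r) ⟩
    21 ℕ.* (r ℕ.* r)                              ∎
    where
    open ℕ.≤-Reasoning
    identity : ∀ c s →
      (3 ℕ.+ 2 ℕ.* (suc (suc c ℕ.+ suc c) ℕ.* suc (suc c ℕ.+ suc c)) ℕ.+ (13 ℕ.* c ℕ.* c ℕ.+ 18 ℕ.* c)) ℕ.* (s ℕ.* s)
        ≡ 21 ℕ.* (suc c ℕ.* s ℕ.* (suc c ℕ.* s))
    identity = ℕ.solve-∀

  gridPoint : ∀ K → Fin (K ℕ.* K) → ℤ²
  gridPoint K i = + toℕ (proj₁ (Fin.remQuot {K} K i)) , + toℕ (proj₂ (Fin.remQuot {K} K i))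

  gridPoint-injective : ∀ K {i j} → gridPoint K i ≡ gridPoint K j → i ≡ j
  gridPoint-injective K {i} {j} same = begin
    i                                   ≡⟨ Fin.combine-remQuot {K} K i ⟨
    uncurry combine (Fin.remQuot {K} K i)   ≡⟨ cong (uncurry combine) remQuot≡ ⟩
    uncurry combine (Fin.remQuot {K} K j)   ≡⟨ Fin.combine-remQuot {K} K j ⟩
    j                                   ∎
    where
    open ≡-Reasoning
    remQuot≡ : Fin.remQuot {K} K i ≡ Fin.remQuot {K} K j
    remQuot≡ = cong₂ _,_ (Fin.toℕ-injective (ℤ.+-injective (,-injectiveˡ same)))
                         (Fin.toℕ-injective (ℤ.+-injective (,-injectiveʳ same)))

  ‖gridPoint-gridPoint‖≤ : ∀ b i j → ‖ gridPoint (suc b) i -² gridPoint (suc b) j ‖ ℕ.≤ b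
  ‖gridPoint-gridPoint‖≤ b i j = ℕ.⊔-lub
    (∣m-n∣≤ _ _ (toℕ≤b (proj₁ (Fin.remQuot {suc b} (suc b) i))) (toℕ≤b (proj₁ (Fin.remQuot {suc b} (suc b) j))))
    (∣m-n∣≤ _ _ (toℕ≤b (proj₂ (Fin.remQuot {suc b} (suc b) i))) (toℕ≤b (proj₂ (Fin.remQuot {suc b} (suc b) j))))
    where
    toℕ≤b : (x : Fin (suc b)) → toℕ x ℕ.≤ b
    toℕ≤b x = ℕ.s≤s⁻¹ (Fin.toℕ<n x)

  unit-transversal : ∀ k → content k ≡ 1 → ∃ λ u → ‖ u ‖ ℕ.≤ 1 × det k u ≢ 0ℤ
  unit-transversal (k₁ , k₂) content≡1 with k₁ ℤ.≟ 0ℤ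
  ... | no  k₁≢0 = (0ℤ , 1ℤ) , ℕ.≤-refl , k₁≢0 ∘ trans (sym (identity k₁ k₂))
    where
    identity : ∀ k₁ k₂ → k₁ * 1ℤ - k₂ * 0ℤ ≡ k₁
    identity = solve-∀
  ... | yes refl = (1ℤ , 0ℤ) , ℕ.≤-refl , k₂≢0 ∘ ℤ.neg-injective ∘ trans (sym (identity k₂))
    where
    identity : ∀ k₂ → 0ℤ * 0ℤ - k₂ * 1ℤ ≡ - k₂
    identity = solve-∀
    k₂≢0 : k₂ ≢ 0ℤ
    k₂≢0 refl = contradiction (trans (sym ℕ.gcd[0,0]≡0) content≡1) λ ()

  ∣²-combination : ∀ {d c c′} v w → d ∣ c → d ∣ c′ → d ∣² c · v +² c′ · w
  ∣²-combination (v₁ , v₂) (w₁ , w₂) d∣c d∣c′ =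
      ℤ.∣m∣n⇒∣m+n (ℤ.∣m⇒∣m*n v₁ d∣c) (ℤ.∣m⇒∣m*n w₁ d∣c′)
    , ℤ.∣m∣n⇒∣m+n (ℤ.∣m⇒∣m*n v₂ d∣c) (ℤ.∣m⇒∣m*n w₂ d∣c′)

  JointlyCoprime : ℕ → ℤ² → Set
  JointlyCoprime N a = ∀ {h} → + h ∣² a → h ℕ.∣ N → h ≡ 1

  residual : ∀ a k y → proj₁ y * proj₁ k + proj₂ y * proj₂ k ≡ 1ℤ →
             a ≡ (proj₁ a * proj₁ y + proj₂ a * proj₂ y) · k +² det a k · (proj₂ y , - proj₁ y)
  residual (a₁ , a₂) (k₁ , k₂) (y₁ , y₂) bézout = cong₂ _,_
    (trans (×bézout a₁) (identity₁ a₁ a₂ k₁ k₂ y₁ y₂))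
    (trans (×bézout a₂) (identity₂ a₁ a₂ k₁ k₂ y₁ y₂))
    where
    ×bézout : ∀ x → x ≡ x * (y₁ * k₁ + y₂ * k₂)
    ×bézout x = trans (sym (ℤ.*-identityʳ x)) (cong (x *_) (sym bézout))
    identity₁ : ∀ a₁ a₂ k₁ k₂ y₁ y₂ →
      a₁ * (y₁ * k₁ + y₂ * k₂) ≡ (a₁ * y₁ + a₂ * y₂) * k₁ + (a₁ * k₂ - a₂ * k₁) * y₂
    identity₁ = solve-∀
    identity₂ : ∀ a₁ a₂ k₁ k₂ y₁ y₂ →
      a₂ * (y₁ * k₁ + y₂ * k₂) ≡ (a₁ * y₁ + a₂ * y₂) * k₂ + (a₁ * k₂ - a₂ * k₁) * - y₁
    identity₂ = solve-∀

  scaled-residual : ∀ e u u₀ D k y → e · (u₀ · k +² D · y -² u · k) ≡ (e * D) · y +² - (e * (u - u₀)) · k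
  scaled-residual e u u₀ D (k₁ , k₂) (y₁ , y₂) = cong₂ _,_ (identity e u u₀ D k₁ y₁) (identity e u u₀ D k₂ y₂)
    where
    identity : ∀ e u u₀ D k y → e * (u₀ * k + D * y - u * k) ≡ e * D * y + - (e * (u - u₀)) * k
    identity = solve-∀

  -- a = u₀·k + det a k·y′ by Bézout, and u₀ is a unit modulo M = N / gcd(N, e) since M ∣ det a k;
  -- any unit u ≡ u₀ (mod M) then gives N ∣ e·(a − u·k).
  representation : ∀ N .{{_ : NonZero N}} e a k → JointlyCoprime N a → content k ≡ 1 → + N ∣ + e * det a k →
                   ∃ λ u → Coprime ∣ u ∣ N × + N ∣² + e · (a -² u · k)
  representation N e a k jointly-coprime content≡1 N∣eD =
    let y₁ , y₂ , bézout-k = bézout (proj₁ k) (proj₂ k) (Coprimality.gcd≡1⇒coprime content≡1)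
        u₀ = proj₁ a * y₁ + proj₂ a * y₂
        a≡ = residual a k (y₁ , y₂) bézout-k
        u , M∣u-u₀ , u⊥N = lift-unit u₀ M∣N (u₀⊥M u₀ (y₂ , - y₁) a≡)
    in  u , u⊥N , subst (λ b → + N ∣² + e · (b -² u · k)) (sym a≡)
                    (subst (+ N ∣²_) (sym (scaled-residual (+ e) u u₀ D k (y₂ , - y₁)))
                      (∣²-combination (y₂ , - y₁) k N∣eD (ℤ.∣m⇒∣-m (M∣x⇒N∣e*x M∣u-u₀))))
    where
    D = det a k
    open ReducedFraction (reduce (+ e) N)
      using () renaming (numerator to e′; denominator to M; common to h; N≡denominator*common to N≡M*h;
                         D≡numerator*common to e≡e′*h)
    M∣D : + M ∣ D
    M∣D = denominator-minimal (reduce (+ e) N) D (subst (+ N ∣_) (ℤ.*-comm (+ e) D) N∣eD)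
    M∣N : M ℕ.∣ N
    M∣N = ℕ.divides h (trans N≡M*h (ℕ.*-comm M h))
    u₀⊥M : ∀ u₀ y → a ≡ u₀ · k +² D · y → Coprime ∣ u₀ ∣ M
    u₀⊥M u₀ y a≡ {z} (z∣u₀ , z∣M) =
      jointly-coprime
        (subst (+ z ∣²_) (sym a≡) (∣²-combination k y (∣ᵤ⇒∣ {+ z} {u₀} z∣u₀) (ℤ.∣-trans (∣ᵤ⇒∣ {+ z} {+ M} z∣M) M∣D)))
        (ℕ.∣-trans z∣M M∣N)
    M∣x⇒N∣e*x : ∀ {x} → + M ∣ x → + N ∣ + e * x
    M∣x⇒N∣e*x {x} M∣x = subst₂ _∣_ (sym (+N≡denominator*common (reduce (+ e) N))) e*x≡
      (ℤ.∣n⇒∣m*n e′ (ℤ.*-monoˡ-∣ (+ h) M∣x))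
      where
      e*x≡ : e′ * (x * + h) ≡ + e * x
      e*x≡ = trans (x∙yz≈xz∙y e′ x (+ h)) (cong (_* x) (sym e≡e′*h))

  -- e ≤ 21·C²·N^(1−c) and ‖k‖ > C with c = p/q and C = r/s, cleared of denominators.
  SmallTorsion : (N p q r s e : ℕ) → Set
  SmallTorsion N p q r s e = (e ℕ.* (s ℕ.* s)) ℕ.^ q ℕ.≤ (21 ℕ.* (r ℕ.* r)) ℕ.^ q ℕ.* N ℕ.^ (q ℕ.∸ p)

  LongDirection : (r s : ℕ) → ℤ² → Set
  LongDirection r s k = r ℕ.< ‖ k ‖ ℕ.* s

  record Approximation (N : ℕ) (a : ℤ²) (p q r s : ℕ) : Set where
    field
      e : ℕ
      k : ℤ²
      1≤e : 1 ℕ.≤ e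
      content≡1 : content k ≡ 1
      N∣e*det : + N ∣ + e * det a k
      size : (e ℕ.* ‖ k ‖) ℕ.^ q ℕ.≤ N ℕ.^ p
      small-or-long : SmallTorsion N p q r s e ⊎ LongDirection r s k

  module _ (N : ℕ) .{{_ : NonZero N}} (a : ℤ²) where

    short-vector : ∀ b → N ℕ.< suc b ℕ.* suc b → ∃ λ v → v ≢ 0² × ‖ v ‖ ℕ.≤ b × + N ∣ det a v
    short-vector b N<K² =
      let i , j , i<j , residue≡ = Fin.pigeonhole N<K² residue
      in  point j -² point i
        , Fin.<⇒≢ i<j ∘ sym ∘ gridPoint-injective K ∘ -²≡0²⇒≡ (point j) (point i)
        , ‖gridPoint-gridPoint‖≤ b j i
        , subst (+ N ∣_) (sym (det-minusʳ a (point j) (point i)))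
            (%ℕ≡⇒∣- N (det a (point j)) (det a (point i)) (residue-toℕ j i (sym residue≡)))
      where
      K = suc b
      point = gridPoint K
      residue : Fin (K ℕ.* K) → Fin N
      residue i = fromℕ< (ℤ.n%ℕd<d (det a (point i)) N)
      residue-toℕ : ∀ i j → residue i ≡ residue j → det a (point i) ℤ.%ℕ N ≡ det a (point j) ℤ.%ℕ N
      residue-toℕ i j same = trans (sym (Fin.toℕ-fromℕ< _)) (trans (cong toℕ same) (Fin.toℕ-fromℕ< _))

    det≡content*det[primitivePart] : ∀ x → det a x ≡ + content x * det a (primitivePart x)
    det≡content*det[primitivePart] x =
      trans (cong (det a) (sym (content·primitivePart x))) (det-·ʳ (+ content x) a (primitivePart x))

    module Direction (k : ℤ²) (content≡1 : content k ≡ 1) where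
      open ReducedFraction (reduce (det a k) N)
        renaming (numerator to δ; denominator to m; common to h; N≡denominator*common to N≡m*h;
                  D≡numerator*common to D≡δ*h)

      instance
        m≢0 : NonZero m
        m≢0 = denominator≢0 (reduce (det a k) N)

      h≢0 : + h ≢ 0ℤ
      h≢0 = ℕ.≢-nonZero⁻¹ h {{common≢0 (reduce (det a k) N)}} ∘ ℤ.+-injective

      N∣det[a,h·u-ℓ·k] : ∀ u ℓ → + m ∣ + ℓ * δ - det a u → + N ∣ det a (+ h · u +² - + ℓ · k)
      N∣det[a,h·u-ℓ·k] u ℓ (divides c ℓδ-X≡cm) = divides (- c) (begin
        det a (+ h · u +² - + ℓ · k)                   ≡⟨ det-+²ʳ a (+ h · u) (- + ℓ · k) ⟩
        det a (+ h · u) + det a (- + ℓ · k)            ≡⟨ cong₂ _+_ (det-·ʳ (+ h) a u) (det-·ʳ (- + ℓ) a k) ⟩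
        + h * det a u + - + ℓ * det a k                ≡⟨ cong (λ t → + h * det a u + - + ℓ * t) D≡δ*h ⟩
        + h * det a u + - + ℓ * (δ * + h)              ≡⟨ identity (+ h) (det a u) (+ ℓ) δ ⟩
        - (+ ℓ * δ - det a u) * + h                    ≡⟨ cong (λ t → - t * + h) ℓδ-X≡cm ⟩
        - (c * + m) * + h                              ≡⟨ identity′ c (+ m) (+ h) ⟩
        - c * (+ m * + h)                              ≡⟨ cong (λ n → - c * n) (+N≡denominator*common (reduce (det a k) N)) ⟨
        - c * + N                                      ∎)
        where
        open ≡-Reasoning
        identity : ∀ h X ℓ δ → h * X + - ℓ * (δ * h) ≡ - (ℓ * δ - X) * h
        identity = solve-∀
        identity′ : ∀ c m h → - (c * m) * h ≡ - c * (m * h)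
        identity′ = solve-∀

      det[k,h·u-ℓ·k] : ∀ u ℓ → det k (+ h · u +² - + ℓ · k) ≡ + h * det k u
      det[k,h·u-ℓ·k] u ℓ = begin
        det k (+ h · u +² - + ℓ · k)         ≡⟨ det-+²ʳ k (+ h · u) (- + ℓ · k) ⟩
        det k (+ h · u) + det k (- + ℓ · k)  ≡⟨ cong₂ _+_ (det-·ʳ (+ h) k u) (det-·ʳ (- + ℓ) k k) ⟩
        + h * det k u + - + ℓ * det k k      ≡⟨ cong (λ t → + h * det k u + - + ℓ * t) (det-self k) ⟩
        + h * det k u + - + ℓ * 0ℤ           ≡⟨ identity (+ h * det k u) (- + ℓ) ⟩
        + h * det k u                        ∎
        where
        open ≡-Reasoning
        identity : ∀ x y → x + y * 0ℤ ≡ x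
        identity = solve-∀

      ‖h·u-ℓ·k‖≤ : ∀ u ℓ → ‖ u ‖ ℕ.≤ 1 → ℓ ℕ.< m → ‖ + h · u +² - + ℓ · k ‖ ℕ.≤ h ℕ.+ m ℕ.* ‖ k ‖
      ‖h·u-ℓ·k‖≤ u ℓ ‖u‖≤1 ℓ<m = begin
        ‖ + h · u +² - + ℓ · k ‖               ≤⟨ ‖+²‖ (+ h · u) (- + ℓ · k) ⟩
        ‖ + h · u ‖ ℕ.+ ‖ - + ℓ · k ‖
                                               ≡⟨ cong₂ ℕ._+_ (‖·‖ (+ h) u) (trans (‖·‖ (- + ℓ) k) (cong (ℕ._* ‖ k ‖) (ℤ.∣-i∣≡∣i∣ (+ ℓ)))) ⟩
        h ℕ.* ‖ u ‖ ℕ.+ ℓ ℕ.* ‖ k ‖            ≤⟨ ℕ.+-mono-≤ (ℕ.*-monoʳ-≤ h ‖u‖≤1) (ℕ.*-monoˡ-≤ ‖ k ‖ (ℕ.<⇒≤ ℓ<m)) ⟩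
        h ℕ.* 1 ℕ.+ m ℕ.* ‖ k ‖                ≡⟨ cong (ℕ._+ m ℕ.* ‖ k ‖) (ℕ.*-identityʳ h) ⟩
        h ℕ.+ m ℕ.* ‖ k ‖                      ∎
        where open ℕ.≤-Reasoning

      -- With det a k = δ·h and N = m·h, take w = h·u − ℓ·k where ℓ·δ ≡ det a u (mod m).
      transversal : ∃ λ w → (+ N ∣ det a w) × det k w ≢ 0ℤ × ‖ w ‖ ℕ.≤ h ℕ.+ m ℕ.* ‖ k ‖
      transversal =
        let u , ‖u‖≤1 , det[k,u]≢0 = unit-transversal k content≡1
            ℓ , ℓ<m , m∣ℓδ-X = linear-congruence m δ (det a u) (Coprimality.sym coprime)
        in  + h · u +² - + ℓ · k
          , N∣det[a,h·u-ℓ·k] u ℓ m∣ℓδ-X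
          , subst (_≢ 0ℤ) (sym (det[k,h·u-ℓ·k] u ℓ)) (*-≢0 h≢0 det[k,u]≢0)
          , ‖h·u-ℓ·k‖≤ u ℓ ‖u‖≤1 ℓ<m

      line : ℤ² → ℕ → ℤ²
      line w t = + m · k +² + suc t · w

      det[line,line]≢0 : ∀ w → det k w ≢ 0ℤ → ∀ {i j} → i ℕ.< j → det (line w i) (line w j) ≢ 0ℤ
      det[line,line]≢0 w det[k,w]≢0 {i} {j} i<j =
        subst (_≢ 0ℤ) (sym (det-·+²· (+ m) (+ suc i) (+ suc j) k w))
          (*-≢0 (ℕ.≢-nonZero⁻¹ m ∘ ℤ.+-injective) (*-≢0 j-i≢0 det[k,w]≢0))
        where
        j-i≢0 : + suc j - + suc i ≢ 0ℤ
        j-i≢0 = ℕ.<⇒≢ i<j ∘ sym ∘ ℕ.suc-injective ∘ ℤ.+-injective ∘ ℤ.i-j≡0⇒i≡j _ _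

      line≢0² : ∀ w → det k w ≢ 0ℤ → ∀ t → line w t ≢ 0²
      line≢0² w det[k,w]≢0 t =
        det≢0⇒≢0² k (line w t) (subst (_≢ 0ℤ) (sym (det-·+²ʳ (+ m) (+ suc t) k w)) (*-≢0 {+ suc t} (λ ()) det[k,w]≢0))

      N∣det[a,line] : ∀ w t → + N ∣ det a w → + N ∣ det a (line w t)
      N∣det[a,line] w t N∣det[a,w] = subst (+ N ∣_) (sym det[a,line]≡)
        (ℤ.∣m∣n⇒∣m+n (N∣denominator*D (reduce (det a k) N)) (ℤ.∣n⇒∣m*n (+ suc t) N∣det[a,w]))
        where
        det[a,line]≡ : det a (line w t) ≡ + m * det a k + + suc t * det a w
        det[a,line]≡ = trans (det-+²ʳ a (+ m · k) (+ suc t · w)) (cong₂ _+_ (det-·ʳ (+ m) a k) (det-·ʳ (+ suc t) a w))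

      m‖line‖≤ : m ℕ.* (m ℕ.* ‖ k ‖) ℕ.≤ N → ∀ w t → ‖ w ‖ ℕ.≤ h ℕ.+ m ℕ.* ‖ k ‖ →
                 m ℕ.* ‖ line w t ‖ ℕ.≤ (3 ℕ.+ 2 ℕ.* t) ℕ.* N
      m‖line‖≤ m²‖k‖≤N w t ‖w‖≤ = begin
        m ℕ.* ‖ line w t ‖                                             ≤⟨ ℕ.*-monoʳ-≤ m (‖+²‖ (+ m · k) (+ suc t · w)) ⟩
        m ℕ.* (‖ + m · k ‖ ℕ.+ ‖ + suc t · w ‖)                        ≡⟨ cong (m ℕ.*_) (cong₂ ℕ._+_ (‖·‖ (+ m) k) (‖·‖ (+ suc t) w)) ⟩
        m ℕ.* (m ℕ.* ‖ k ‖ ℕ.+ suc t ℕ.* ‖ w ‖)                        ≤⟨ ℕ.*-monoʳ-≤ m (ℕ.+-monoʳ-≤ (m ℕ.* ‖ k ‖) (ℕ.*-monoʳ-≤ (suc t) ‖w‖≤)) ⟩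
        m ℕ.* (m ℕ.* ‖ k ‖ ℕ.+ suc t ℕ.* (h ℕ.+ m ℕ.* ‖ k ‖))          ≡⟨ identity m (‖ k ‖) t h ⟩
        m ℕ.* (m ℕ.* ‖ k ‖) ℕ.+ suc t ℕ.* (m ℕ.* h ℕ.+ m ℕ.* (m ℕ.* ‖ k ‖))
           ≤⟨ ℕ.+-mono-≤ m²‖k‖≤N (ℕ.*-monoʳ-≤ (suc t) (ℕ.+-mono-≤ (ℕ.≤-reflexive (sym N≡m*h)) m²‖k‖≤N)) ⟩
        N ℕ.+ suc t ℕ.* (N ℕ.+ N)                                      ≡⟨ identity′ N t ⟩
        (3 ℕ.+ 2 ℕ.* t) ℕ.* N                                          ∎
        where
        open ℕ.≤-Reasoning
        identity : ∀ m K t h → m ℕ.* (m ℕ.* K ℕ.+ suc t ℕ.* (h ℕ.+ m ℕ.* K)) ≡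
                               m ℕ.* (m ℕ.* K) ℕ.+ suc t ℕ.* (m ℕ.* h ℕ.+ m ℕ.* (m ℕ.* K))
        identity = ℕ.solve-∀
        identity′ : ∀ N t → N ℕ.+ suc t ℕ.* (N ℕ.+ N) ≡ (3 ℕ.+ 2 ℕ.* t) ℕ.* N
        identity′ = ℕ.solve-∀

      -- The lattice vectors on the line through m·k in direction w are pairwise non-parallel, so among
      -- boxSize C + 1 of them one has a primitive part of norm greater than C.
      far-vector : m ℕ.* (m ℕ.* ‖ k ‖) ℕ.≤ N → ∀ C →
                   ∃ λ x → x ≢ 0² × (+ N ∣ det a x) × C ℕ.< ‖ primitivePart x ‖ ×
                           m ℕ.* ‖ x ‖ ℕ.≤ (3 ℕ.+ 2 ℕ.* boxSize C) ℕ.* N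
      far-vector m²‖k‖≤N C =
        let w , N∣det[a,w] , det[k,w]≢0 , ‖w‖≤ = transversal
            t , C<‖x‖ = long-primitivePart C (ℕ.n<1+n (boxSize C)) (line w ∘ toℕ)
                          (det[line,line]≢0 w det[k,w]≢0)
        in  line w (toℕ t)
          , line≢0² w det[k,w]≢0 (toℕ t)
          , N∣det[a,line] w (toℕ t) N∣det[a,w]
          , C<‖x‖
          , ℕ.≤-trans (m‖line‖≤ m²‖k‖≤N w (toℕ t) ‖w‖≤)
                      (ℕ.*-monoˡ-≤ N (ℕ.+-monoʳ-≤ 3 (ℕ.*-monoʳ-≤ 2 (ℕ.s≤s⁻¹ (Fin.toℕ<n t)))))

      near-approximation : ∀ p q r s → (m ℕ.* ‖ k ‖) ℕ.^ q ℕ.≤ N ℕ.^ p →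
                           SmallTorsion N p q r s m ⊎ LongDirection r s k →
                           Approximation N a p q r s
      near-approximation p q r s size small-or-long = record
        { e = m
        ; k = k
        ; 1≤e = ℕ.>-nonZero⁻¹ m
        ; content≡1 = content≡1
        ; N∣e*det = N∣denominator*D (reduce (det a k) N)
        ; size = size
        ; small-or-long = small-or-long
        }

      far-approximation : ∀ p q r s .{{_ : NonZero s}} → p ℕ.≤ q → s ℕ.≤ r → m ℕ.* (m ℕ.* ‖ k ‖) ℕ.≤ N →
                          ¬ SmallTorsion N p q r s m → Approximation N a p q r s
      far-approximation p q r s p≤q s≤r m²‖k‖≤N not-small =
        let x , x≢0 , N∣det[a,x] , C<‖k′‖ , m‖x‖≤ = far-vector m²‖k‖≤N C
        in record
          { e = content x
          ; k = primitivePart x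
          ; 1≤e = ℕ.>-nonZero⁻¹ (content x) {{content≢0 x x≢0}}
          ; content≡1 = primitivePart-primitive x x≢0
          ; N∣e*det = subst (+ N ∣_) (det≡content*det[primitivePart] x) N∣det[a,x]
          ; size = subst (λ n → n ℕ.^ q ℕ.≤ N ℕ.^ p) (‖‖≡content*‖primitivePart‖ x)
                     (xy≤zn⇒x^q≤n^p ‖ x ‖ (m ℕ.* (s ℕ.* s)) (21 ℕ.* (r ℕ.* r)) N p q
                        (‖x‖ms²≤ x m‖x‖≤) (ℕ.≰⇒> not-small) p≤q)
          ; small-or-long = inj₂ (ℕ.<-≤-trans (m<[1+m/n]*n r s) (ℕ.*-monoˡ-≤ s C<‖k′‖))
          }
        where
        C = r ℕ./ s
        ‖x‖ms²≤ : ∀ x → m ℕ.* ‖ x ‖ ℕ.≤ (3 ℕ.+ 2 ℕ.* boxSize C) ℕ.* N →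
                  ‖ x ‖ ℕ.* (m ℕ.* (s ℕ.* s)) ℕ.≤ 21 ℕ.* (r ℕ.* r) ℕ.* N
        ‖x‖ms²≤ x m‖x‖≤ = begin
          ‖ x ‖ ℕ.* (m ℕ.* (s ℕ.* s))                      ≡⟨ identity ‖ x ‖ m (s ℕ.* s) ⟩
          m ℕ.* ‖ x ‖ ℕ.* (s ℕ.* s)                        ≤⟨ ℕ.*-monoˡ-≤ (s ℕ.* s) m‖x‖≤ ⟩
          (3 ℕ.+ 2 ℕ.* boxSize C) ℕ.* N ℕ.* (s ℕ.* s)      ≡⟨ identity′ (3 ℕ.+ 2 ℕ.* boxSize C) N (s ℕ.* s) ⟩
          (3 ℕ.+ 2 ℕ.* boxSize C) ℕ.* (s ℕ.* s) ℕ.* N      ≤⟨ ℕ.*-monoˡ-≤ N (boxSize-bound C s r (ℕ.m≥n⇒m/n>0 s≤r) (ℕ.m/n*n≤m r s)) ⟩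
          21 ℕ.* (r ℕ.* r) ℕ.* N                           ∎
          where
          open ℕ.≤-Reasoning
          identity : ∀ x y z → x ℕ.* (y ℕ.* z) ≡ y ℕ.* x ℕ.* z
          identity = ℕ.solve-∀
          identity′ : ∀ x y z → x ℕ.* y ℕ.* z ≡ x ℕ.* z ℕ.* y
          identity′ = ℕ.solve-∀

    approximation-from-short-vector : ∀ p q r s .{{_ : NonZero s}} → q ℕ.≤ p ℕ.+ p → p ℕ.≤ q → s ℕ.≤ r →
                                      ∀ b → b ℕ.* b ℕ.≤ N → ∀ v → v ≢ 0² → ‖ v ‖ ℕ.≤ b → + N ∣ det a v →
                                      Approximation N a p q r s
    approximation-from-short-vector p q r s q≤2p p≤q s≤r b b²≤N v v≢0 ‖v‖≤b N∣det[a,v] =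
      decide (_ ℕ.≤? _) (r ℕ.<? ‖ k ‖ ℕ.* s)
      where
      k = primitivePart v
      content≡1 = primitivePart-primitive v v≢0
      open ReducedFraction (reduce (det a k) N) using () renaming (denominator to m)
      open Direction k content≡1
      instance
        ‖k‖≢0 : NonZero ‖ k ‖
        ‖k‖≢0 = ‖‖≢0 k (content≡1⇒≢0² k content≡1)
      m∣content : m ℕ.∣ content v
      m∣content = ∣⇒∣ᵤ (denominator-minimal (reduce (det a k) N) (+ content v)
                         (subst (+ N ∣_) (det≡content*det[primitivePart] v) N∣det[a,v]))
      m‖k‖≤b : m ℕ.* ‖ k ‖ ℕ.≤ b
      m‖k‖≤b = begin
        m ℕ.* ‖ k ‖           ≤⟨ ℕ.*-monoˡ-≤ ‖ k ‖ (ℕ.∣⇒≤ {{content≢0 v v≢0}} m∣content) ⟩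
        content v ℕ.* ‖ k ‖   ≡⟨ ‖‖≡content*‖primitivePart‖ v ⟨
        ‖ v ‖                 ≤⟨ ‖v‖≤b ⟩
        b                     ∎
        where open ℕ.≤-Reasoning
      m²‖k‖≤N : m ℕ.* (m ℕ.* ‖ k ‖) ℕ.≤ N
      m²‖k‖≤N = ℕ.≤-trans (ℕ.*-mono-≤ (ℕ.≤-trans (ℕ.m≤m*n m ‖ k ‖) m‖k‖≤b) m‖k‖≤b) b²≤N
      size : (m ℕ.* ‖ k ‖) ℕ.^ q ℕ.≤ N ℕ.^ p
      size = ℕ.≤-trans (ℕ.^-monoˡ-≤ q m‖k‖≤b) (b*b≤n⇒b^q≤n^p b N p q b²≤N q≤2p)
      decide : Dec (SmallTorsion N p q r s m) → Dec (LongDirection r s k) → Approximation N a p q r s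
      decide (yes small) _          = near-approximation p q r s size (inj₁ small)
      decide (no _)      (yes long) = near-approximation p q r s size (inj₂ long)
      decide (no large)  (no _)     = far-approximation p q r s p≤q s≤r m²‖k‖≤N large

    approximation : ∀ p q r s → q ℕ.≤ p ℕ.+ p → p ℕ.≤ q → 1 ℕ.≤ s → s ℕ.≤ r → Approximation N a p q r s
    approximation p q r s q≤2p p≤q 1≤s s≤r =
      let instance _ = ℕ.>-nonZero 1≤s
          b , b²≤N , N<[1+b]² = ⌊√ N ⌋
          v , v≢0 , ‖v‖≤b , N∣det[a,v] = short-vector b N<[1+b]²
      in  approximation-from-short-vector p q r s q≤2p p≤q s≤r b b²≤N v v≢0 ‖v‖≤b N∣det[a,v]


module Roots where
  open import Defs
  open Lattice using (JointlyCoprime)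
  open import Data.Integer.Base as ℤ using (ℤ; +_; ∣_∣; _+_; _*_; _-_; 0ℤ)
  import Data.Integer.Properties as ℤ
  open import Data.Integer.Divisibility.Signed using (_∣_; divides; ∣⇒∣ᵤ)
  open import Data.Integer.Tactic.RingSolver using (solve-∀)
  open import Data.Nat.Base as ℕ using (ℕ; suc; NonZero; z≤n; s≤s)
  import Data.Nat.Properties as ℕ
  import Data.Nat.Divisibility as ℕ
  open import Data.Nat.Coprimality as Coprimality using (Coprime)
  open import Data.Rational.Unnormalised.Base as ℚ using (mkℚᵘ; _≃_; *≡*; _/_)
  import Data.Rational.Unnormalised.Properties as ℚ
  open import Data.Product using (∃; _,_)
  open import Function.Bundles using (Equivalence; _⇔_; mk⇔)
  open import Relation.Binary.PropositionalEquality
  open import Relation.Nullary using (contradiction)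

  ≃⇒≈μ : ∀ {x y} → x ≃ y → x ≈μ y
  ≃⇒≈μ {x} {y} x≃y = 0ℤ , ℚ.≃-trans (ℚ.+-congˡ (ℚ.- y) x≃y) (ℚ.+-inverseʳ y)

  IsRootOfUnity-cong : ∀ {n x y} → x ≃ y → IsRootOfUnity n x → IsRootOfUnity n y
  IsRootOfUnity-cong {n} x≃y (j , nx≃j) = j , ℚ.≃-trans (ℚ.*-congˡ {+ n / 1} (ℚ.≃-sym x≃y)) nx≃j

  rootOfUnity-/⇔ : ∀ e A n → IsRootOfUnity e (A / suc n) ⇔ (+ suc n ∣ + e * A)
  rootOfUnity-/⇔ e A n rewrite ℕ.+-identityʳ n = mk⇔
    (λ { (j , *≡* eA≡jN) → divides j (trans (sym (ℤ.*-identityʳ (+ e * A))) eA≡jN) })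
    (λ { (divides j eA≡jN) → j , *≡* (trans (ℤ.*-identityʳ (+ e * A)) eA≡jN) })

  rootOfUnity⇒fraction : ∀ n ζ → IsRootOfUnity (suc n) ζ → ∃ λ A → ζ ≃ A / suc n
  rootOfUnity⇒fraction n (mkℚᵘ z d) (j , *≡* Nz≡jd) rewrite ℕ.+-identityʳ d =
    j , *≡* (trans (ℤ.*-comm z (+ suc n)) (trans (sym (ℤ.*-identityʳ (+ suc n * z))) Nz≡jd))

  fraction-decomposition : ∀ n A u k → A / suc n ≃ ((A - u * k) / suc n) ·μ ((u / suc n) ^μ k)
  fraction-decomposition n A u k = *≡* (begin
    A * + (suc n ℕ.* suc (n ℕ.+ 0))                            ≡⟨ cong (λ d → A * + (suc n ℕ.* suc d)) (ℕ.+-identityʳ n) ⟩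
    A * + (suc n ℕ.* suc n)                                    ≡⟨ cong (A *_) (ℤ.pos-* (suc n) (suc n)) ⟩
    A * (+ suc n * + suc n)                                    ≡⟨ identity A u k (+ suc n) ⟩
    ((A - u * k) * + suc n + k * u * + suc n) * + suc n
                                 ≡⟨ cong (λ d → ((A - u * k) * + suc d + k * u * + suc n) * + suc n) (ℕ.+-identityʳ n) ⟨
    ((A - u * k) * + suc (n ℕ.+ 0) + k * u * + suc n) * + suc n ∎)
    where
    open ≡-Reasoning
    identity : ∀ A u k N → A * (N * N) ≡ ((A - u * k) * N + k * u * N) * N
    identity = solve-∀

  order-minimal⇒jointly-coprime : ∀ n {ζ₁ ζ₂} A₁ A₂ → ζ₁ ≃ A₁ / suc n → ζ₂ ≃ A₂ / suc n →
                                  HasOrder² (suc n) ζ₁ ζ₂ → JointlyCoprime (suc n) (A₁ , A₂)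
  order-minimal⇒jointly-coprime n A₁ A₂ ζ₁≃ ζ₂≃ (_ , _ , _ , minimal) {h} (h∣A₁ , h∣A₂) h∣N =
    ℕ.≤-antisym (ℕ.*-cancelˡ-≤ n₀ {{n₀≢0}} n₀h≤n₀*1) (ℕ.>-nonZero⁻¹ h {{h≢0}})
    where
    n₀ = ℕ.quotient h∣N
    N≡n₀h : suc n ≡ n₀ ℕ.* h
    N≡n₀h = ℕ.m∣n⇒n≡quotient*m h∣N
    n₀≢0 : NonZero n₀
    n₀≢0 = ℕ.quotient≢0 h∣N
    h≢0 : NonZero h
    h≢0 = ℕ.m*n≢0⇒n≢0 n₀ {{subst NonZero N≡n₀h (ℕ.>-nonZero (s≤s z≤n))}}
    root : ∀ {ζ A} → A / suc n ≃ ζ → + h ∣ A → IsRootOfUnity n₀ ζ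
    root {ζ} {A} A/N≃ζ (divides A′ A≡A′h) =
      IsRootOfUnity-cong A/N≃ζ (Equivalence.from (rootOfUnity-/⇔ n₀ A n) (divides A′ (begin
        + n₀ * A                ≡⟨ cong (+ n₀ *_) A≡A′h ⟩
        + n₀ * (A′ * + h)       ≡⟨ identity (+ n₀) A′ (+ h) ⟩
        A′ * (+ n₀ * + h)       ≡⟨ cong (A′ *_) (ℤ.pos-* n₀ h) ⟨
        A′ * + (n₀ ℕ.* h)       ≡⟨ cong (λ m → A′ * + m) N≡n₀h ⟨
        A′ * + suc n            ∎)))
      where
      open ≡-Reasoning
      identity : ∀ x y z → x * (y * z) ≡ y * (x * z)
      identity = solve-∀
    n₀h≤n₀*1 : n₀ ℕ.* h ℕ.≤ n₀ ℕ.* 1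
    n₀h≤n₀*1 = begin
      n₀ ℕ.* h   ≡⟨ N≡n₀h ⟨
      suc n      ≤⟨ minimal n₀ (ℕ.>-nonZero⁻¹ n₀ {{n₀≢0}}) (root (ℚ.≃-sym ζ₁≃) h∣A₁) (root (ℚ.≃-sym ζ₂≃) h∣A₂) ⟩
      n₀         ≡⟨ ℕ.*-identityʳ n₀ ⟨
      n₀ ℕ.* 1   ∎
      where open ℕ.≤-Reasoning

  unit⇒primitiveRoot : ∀ n u → Coprime ∣ u ∣ (suc n) → IsPrimitiveRoot (suc n) (u / suc n)
  unit⇒primitiveRoot n u u⊥N =
      s≤s z≤n
    , Equivalence.from (rootOfUnity-/⇔ (suc n) u n) (divides u (ℤ.*-comm (+ suc n) u))
    , λ m 1≤m m<N root → contradiction (ℕ.∣⇒≤ {{ℕ.>-nonZero 1≤m}} (N∣m root)) (ℕ.<⇒≱ m<N)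
    where
    N∣m : ∀ {m} → IsRootOfUnity m (u / suc n) → suc n ℕ.∣ m
    N∣m {m} root = Coprimality.coprime-divisor (Coprimality.sym u⊥N)
      (subst (suc n ℕ.∣_) (trans (ℤ.abs-* (+ m) u) (ℕ.*-comm m ∣ u ∣))
        (∣⇒∣ᵤ (Equivalence.to (rootOfUnity-/⇔ m u n) root)))


open import Defs
open import Data.Nat using (ℕ; _≤_; _<_; _*_; _^_; _∸_)
open import Data.Integer using (ℤ; +_)
open import Data.Integer.GCD using (gcd)
open import Data.Rational.Unnormalised using (ℚᵘ)
open import Data.Product using (Σ; ∃; ∃-syntax; _×_)
open import Data.Sum using (_⊎_)
open import Relation.Binary.PropositionalEquality using (_≡_)

open import Data.Nat using (zero; suc; s≤s; z≤n)
open import Data.Product using (_,_; proj₁; proj₂)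
open import Data.Rational.Unnormalised using (_/_)
open import Data.Rational.Unnormalised.Properties using (≃-trans)
open import Function.Bundles using (Equivalence)
open import Relation.Binary.PropositionalEquality using (cong)
open Lattice using (Approximation; approximation; representation; _-²_; _·_)
open Roots
open Arithmetic using (3q≤4p⇒q≤p+p)

lemma4 : ∃[ C₁ ] (1 ≤ C₁ ×
           (∀ (p q r s : ℕ) → 1 ≤ q → 3 * q ≤ 4 * p → p ≤ q → 1 ≤ s → s ≤ r →
            ∀ (N : ℕ) → 17 ≤ N → ∀ (ζ₁ ζ₂ : ℚᵘ) → HasOrder² N ζ₁ ζ₂ →
            ∃[ ζN ] (IsPrimitiveRoot N ζN ×
            ∃[ e ] (1 ≤ e ×
            ∃[ k₁ ] ∃[ k₂ ] (gcd k₁ k₂ ≡ + 1 ×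
              (e * ∣ k₁ , k₂ ∣∞) ^ q ≤ N ^ p ×
            ∃[ η₁ ] ∃[ η₂ ] (IsRootOfUnity e η₁ × IsRootOfUnity e η₂ ×
              ζ₁ ≈μ (η₁ ·μ (ζN ^μ k₁)) × ζ₂ ≈μ (η₂ ·μ (ζN ^μ k₂)) ×
              ((e * (s * s)) ^ q ≤ (C₁ * (r * r)) ^ q * N ^ (q ∸ p)
               ⊎ r < ∣ k₁ , k₂ ∣∞ * s)))))))
lemma4 = 21 , s≤s z≤n , λ where
  _ _ _ _ _ _ _ _ _ zero () _ _ _
  p q r s _ 3q≤4p p≤q 1≤s s≤r (suc n) _ ζ₁ ζ₂ order@(_ , root₁ , root₂ , _) →
    let A₁ , ζ₁≃A₁/N = rootOfUnity⇒fraction n ζ₁ root₁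
        A₂ , ζ₂≃A₂/N = rootOfUnity⇒fraction n ζ₂ root₂
        a = A₁ , A₂
        open Approximation (approximation (suc n) a p q r s (3q≤4p⇒q≤p+p p q 3q≤4p) p≤q 1≤s s≤r)
        u , u⊥N , N∣e[A₁-uk₁] , N∣e[A₂-uk₂] =
          representation (suc n) e a k (order-minimal⇒jointly-coprime n A₁ A₂ ζ₁≃A₁/N ζ₂≃A₂/N order)
                         content≡1 N∣e*det
    in  u / suc n , unit⇒primitiveRoot n u u⊥N
      , e , 1≤e , proj₁ k , proj₂ k , cong (λ g → + g) content≡1 , size
      , proj₁ (a -² u · k) / suc n , proj₂ (a -² u · k) / suc n
      , Equivalence.from (rootOfUnity-/⇔ e _ n) N∣e[A₁-uk₁]
      , Equivalence.from (rootOfUnity-/⇔ e _ n) N∣e[A₂-uk₂]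
      , ≃⇒≈μ (≃-trans ζ₁≃A₁/N (fraction-decomposition n A₁ u (proj₁ k)))
      , ≃⇒≈μ (≃-trans ζ₂≃A₂/N (fraction-decomposition n A₂ u (proj₂ k)))
      , small-or-long
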